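{- Let $T$ be a tree of order $n\geq 4$ with diameter $\operatorname{diam}(T)=3$. Then $$\gamma_t(M(T))= \begin{cases} n-2 & \text{if there are two vertices } v \text{ of } T \text{ with } d_T(v)\ge3,\\ n-1 & \text{otherwise.} \end{cases}$$
   Context: All graphs are finite and simple. $d_T(v)$ denotes the degree of $v$ in $T$, and $\operatorname{diam}(T)$ is the maximum distance between two vertices of $T$. For a graph $H$ with no isolated vertices, a total dominating set of $H$ is a set $S\subseteq V(H)$ such that every vertex of $H$ has at least one neighbor in $S$; $\gamma_t(H)$ is the minimum cardinality of a total dominating set of $H$. The middle graph $M(G)$ of a graph $G$ has vertex set $V(G)\cup E(G)$ (disjoint union), and two of its vertices $x,y$ are adjacent exactly when either $x,y\in E(G)$ are edges of $G$ sharing a common endpoint, or $x\in V(G)$, $y\in E(G)$ and $x$ is an endpoint of $y$ (no two elements of $V(G)$ are adjacent in $M(G)$). -}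

module Defs where

open import Data.Bool using (Bool; true; false; T; if_then_else_)
open import Data.Nat using (ℕ; zero; suc; _≤_; _<_)
open import Data.Fin using (Fin; toℕ)
open import Data.List using (List; []; _∷_; _++_; [_]; length; allFin; map)
open import Data.Nat.ListAction using (sum)
open import Data.List.Membership.Propositional using (_∈_)
open import Data.List.Relation.Unary.Unique.Propositional using (Unique)
open import Data.List.Relation.Unary.Linked using (Linked)
open import Data.Product using (Σ; ∃; _×_; _,_; proj₁)
open import Data.Sum using (_⊎_)
open import Data.Empty using (⊥)
open import Relation.Binary.PropositionalEquality using (_≡_; _≢_)

record Graph (n : ℕ) : Set where
  field
    adj   : Fin n → Fin n → Bool
    sym   : ∀ u v → adj u v ≡ adj v u
    irref : ∀ u → adj u u ≡ false

open Graph public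

Adj : ∀ {n} → Graph n → Fin n → Fin n → Set
Adj G u v = T (adj G u v)

deg : ∀ {n} → Graph n → Fin n → ℕ
deg {n} G v = sum (map (λ u → if adj G v u then 1 else 0) (allFin n))

data Walk {n : ℕ} (G : Graph n) : Fin n → Fin n → ℕ → Set where
  here : ∀ {u} → Walk G u u 0
  step : ∀ {u w v k} → Adj G u w → Walk G w v k → Walk G u v (suc k)

Connected : ∀ {n} → Graph n → Set
Connected G = ∀ u v → ∃ λ k → Walk G u v k

HasCycle : ∀ {n} → Graph n → Set
HasCycle {n} G = Σ (Fin n) λ x → Σ (List (Fin n)) λ ys →
  (2 ≤ length ys) × Unique (x ∷ ys) × Linked (Adj G) (x ∷ ys ++ [ x ])

IsTree : ∀ {n} → Graph n → Set
IsTree G = Connected G × (HasCycle G → ⊥)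

-- diam(G) = d : every pair at distance ≤ d, and some pair at distance ≥ d
-- (distance = length of a shortest walk)
HasDiameter : ∀ {n} → Graph n → ℕ → Set
HasDiameter {n} G d =
  (∀ u v → ∃ λ k → k ≤ d × Walk G u v k) ×
  (Σ (Fin n) λ u → Σ (Fin n) λ v → ∀ k → Walk G u v k → d ≤ k)

Edge : ∀ {n} → Graph n → Set
Edge {n} G = Σ (Fin n × Fin n) λ p → (toℕ (proj₁ p) < toℕ (Data.Product.proj₂ p)) × Adj G (proj₁ p) (Data.Product.proj₂ p)

MVertex : ∀ {n} → Graph n → Set
MVertex {n} G = Fin n ⊎ Edge G

MAdj : ∀ {n} (G : Graph n) → MVertex G → MVertex G → Set
MAdj G (Data.Sum.inj₁ x) (Data.Sum.inj₁ y) = ⊥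
MAdj G (Data.Sum.inj₁ x) (Data.Sum.inj₂ ((i , j) , _)) = (x ≡ i) ⊎ (x ≡ j)
MAdj G (Data.Sum.inj₂ ((i , j) , _)) (Data.Sum.inj₁ x) = (x ≡ i) ⊎ (x ≡ j)
MAdj G (Data.Sum.inj₂ ((i , j) , _)) (Data.Sum.inj₂ ((k , l) , _)) =
  ((i , j) ≢ (k , l)) × ((i ≡ k) ⊎ (i ≡ l) ⊎ (j ≡ k) ⊎ (j ≡ l))

IsTotalDominating : {V : Set} → (V → V → Set) → List V → Set
IsTotalDominating {V} R S = ∀ (v : V) → ∃ λ u → (u ∈ S) × R v u

TotalDominationNumber : {V : Set} → (V → V → Set) → ℕ → Set
TotalDominationNumber {V} R k =
  (Σ (List V) λ S → Unique S × IsTotalDominating R S × length S ≡ k) ×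
  (∀ (S : List V) → Unique S → IsTotalDominating R S → k ≤ length S)

TwoVerticesDeg≥3 : ∀ {n} → Graph n → Set
TwoVerticesDeg≥3 {n} G = Σ (Fin n) λ u → Σ (Fin n) λ v →
  (u ≢ v) × (3 ≤ deg G u) × (3 ≤ deg G v)

-- A tree of diameter 3 is a double star: adjacent centres p and q, every other vertex a leaf
-- adjacent to exactly one of them, and each centre carrying a leaf.  In M(T) a vertex of T is
-- adjacent only to the edges at it, so a total dominating set contains, for every leaf, the
-- unique edge at that leaf: at least n − 2 elements.  If each centre carries two leaves, the
-- n − 2 pendant edges suffice, as every pendant edge shares its centre with another one.  If
-- p carries a single leaf x, the edge xp is adjacent in M(T) only to x, p and pq, none of them
-- a pendant edge, so one more element is needed; and the n − 1 edges of T do dominate M(T).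

module Submission where

open import Defs
open import Data.Nat using (ℕ; zero; suc; _+_; _∸_; _≤_; _<_; z≤n; s≤s; z<s; s<s)
open import Data.Nat.Properties using (≤-antisym; ≤-reflexive; ≤-trans; <⇒≱; m<n⇒m≤1+n; ∸-monoˡ-≤; m≤n+o⇒m∸n≤o)
open import Data.Fin using (Fin; zero; suc; _≟_)
open import Data.Fin.Properties using (any?; injective⇒≤; punchIn-injective; punchInᵢ≢i; <-cmp; <-asym; suc-injective)
open import Data.Bool using (Bool; true; false; T; if_then_else_)
open import Data.List using (List; []; _∷_; _++_; [_]; length; map; filter; filterᵇ; allFin)
open import Data.List.Properties using (length-map; length-tabulate; length-++-sucʳ; filter-notAll)
open import Data.Nat.ListAction using (sum)
open import Data.List.Membership.Propositional using (_∈_)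
open import Data.List.Membership.Propositional.Properties
  using (∈-∃++; ∈-++⁻; ∈-++⁺ˡ; ∈-++⁺ʳ; ∈-filter⁺; ∈-filter⁻; ∈-map⁺; ∈-allFin)
open import Data.List.Membership.Setoid.Properties using (index-injective)
open import Data.List.Relation.Binary.Subset.Propositional using (_⊆_)
open import Data.List.Relation.Unary.Any as Any using (Any; here; there; index)
open import Data.List.Relation.Unary.All as All using (All; []; _∷_)
import Data.List.Relation.Unary.All.Properties as Allₚ
open import Data.List.Relation.Unary.AllPairs using ([]; _∷_)
open import Data.List.Relation.Unary.Linked using (Linked; [-]; _∷_)
open import Data.List.Relation.Unary.Unique.Propositional using (Unique)
import Data.List.Relation.Unary.Unique.Propositional.Properties as Unique
open import Data.Product using (∃; ∃₂; _×_; _,_; proj₁; proj₂)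
open import Data.Sum using (_⊎_; inj₁; inj₂; [_,_]′)
import Data.Sum as Sum
open import Data.Sum.Properties using (inj₂-injective)
open import Data.Empty using (⊥; ⊥-elim)
open import Function using (_∘_; id; const; _⇔_; mk⇔; Equivalence)
open import Relation.Binary.Definitions using (tri<; tri≈; tri>)
open import Relation.Binary.PropositionalEquality as ≡ using (_≡_; _≢_; refl; subst; ≢-sym)
open import Relation.Nullary using (¬_; Dec; yes; no; ¬?; _×-dec_)
open import Relation.Nullary.Decidable using (T?)

module _ {A : Set} where

  unique-++⁻ˡ : ∀ xs {ys : List A} → Unique (xs ++ ys) → Unique xs
  unique-++⁻ˡ []       _          = []
  unique-++⁻ˡ (x ∷ xs) (x∉ ∷ u) = Allₚ.++⁻ˡ xs x∉ ∷ unique-++⁻ˡ xs u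

  Unique⇒⊆⇒length≤ : {xs ys : List A} → Unique xs → xs ⊆ ys → length xs ≤ length ys
  Unique⇒⊆⇒length≤ {[]}     _           _   = z≤n
  Unique⇒⊆⇒length≤ {x ∷ xs} (x∉xs ∷ u) x∷xs⊆ys
    with us , vs , refl ← ∈-∃++ (x∷xs⊆ys (here refl)) =
    ≤-trans (s≤s (Unique⇒⊆⇒length≤ u xs⊆us++vs)) (≤-reflexive (≡.sym (length-++-sucʳ us x vs)))
    where
    xs⊆us++vs : xs ⊆ us ++ vs
    xs⊆us++vs z∈xs with ∈-++⁻ us (x∷xs⊆ys (there z∈xs))
    ... | inj₁ z∈us          = ∈-++⁺ˡ z∈us
    ... | inj₂ (here z≡x)    = ⊥-elim (All.lookup x∉xs z∈xs (≡.sym z≡x))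
    ... | inj₂ (there z∈vs)  = ∈-++⁺ʳ us z∈vs

  map⁺-injectiveOn : {B : Set} {P : A → Set} {f : A → B} →
    (∀ {x y} → P x → P y → f x ≡ f y → x ≡ y) →
    ∀ {xs} → All P xs → Unique xs → Unique (map f xs)
  map⁺-injectiveOn inj []         []          = []
  map⁺-injectiveOn inj (px ∷ pxs) (x∉xs ∷ u) =
    Allₚ.map⁺ (All.zipWith (λ (py , x≢y) → x≢y ∘ inj px py) (pxs , x∉xs)) ∷ map⁺-injectiveOn inj pxs u

  sum-indicator≡length-filterᵇ : (b : A → Bool) (xs : List A) →
    sum (map (λ x → if b x then 1 else 0) xs) ≡ length (filterᵇ b xs)
  sum-indicator≡length-filterᵇ b []       = refl
  sum-indicator≡length-filterᵇ b (x ∷ xs) with b x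
  ... | true  = ≡.cong suc (sum-indicator≡length-filterᵇ b xs)
  ... | false = sum-indicator≡length-filterᵇ b xs

injective-off-point⇒≤ : ∀ {n m} (c : Fin n) (f : ∀ w → w ≢ c → Fin m) →
  (∀ {w w′} (h : w ≢ c) (h′ : w′ ≢ c) → f w h ≡ f w′ h′ → w ≡ w′) → n ≤ suc m
injective-off-point⇒≤ {zero}  c f inj = z≤n
injective-off-point⇒≤ {suc n} c f inj =
  s≤s (injective⇒≤ λ {i} {j} eq → punchIn-injective c i j (inj (punchInᵢ≢i c i) (punchInᵢ≢i c j) eq))

total-domination-number : ∀ {V : Set} {R : V → V → Set} {k} (S : List V) → Unique S →
  IsTotalDominating R S → length S ≤ k → (∀ {S′} → IsTotalDominating R S′ → k ≤ length S′) →
  TotalDominationNumber R k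
total-domination-number S unique dom |S|≤k lower =
  (S , unique , dom , ≤-antisym |S|≤k (lower dom)) , λ _ _ dom′ → lower dom′

module GraphProperties {n : ℕ} (G : Graph n) where

  open import Data.List.Membership.DecPropositional (_≟_ {n}) using (_∈?_)

  Adj-sym : ∀ {u v} → Adj G u v → Adj G v u
  Adj-sym {u} {v} = subst T (sym G u v)

  Adj-irrefl : ∀ {u} → ¬ Adj G u u
  Adj-irrefl {u} = subst T (irref G u)

  Adj⇒≢ : ∀ {u v} → Adj G u v → u ≢ v
  Adj⇒≢ u~v refl = Adj-irrefl u~v

  neighbours : Fin n → List (Fin n)
  neighbours v = filterᵇ (adj G v) (allFin n)

  deg≡length-neighbours : ∀ v → deg G v ≡ length (neighbours v)
  deg≡length-neighbours v = sum-indicator≡length-filterᵇ (adj G v) (allFin n)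

  deg≤length : ∀ {v xs} → (∀ {u} → Adj G v u → u ∈ xs) → deg G v ≤ length xs
  deg≤length {v} nbrs⊆xs =
    ≤-trans (≤-reflexive (deg≡length-neighbours v))
            (Unique⇒⊆⇒length≤ (Unique.filter⁺ (T? ∘ adj G v) (Unique.allFin⁺ n))
                               (λ u∈nbrs → nbrs⊆xs (proj₂ (∈-filter⁻ (T? ∘ adj G v) {xs = allFin n} u∈nbrs))))

  length≤deg : ∀ {v xs} → Unique xs → (∀ {u} → u ∈ xs → Adj G v u) → length xs ≤ deg G v
  length≤deg {v} u xs⊆nbrs =
    ≤-trans (Unique⇒⊆⇒length≤ u (λ {u} u∈xs → ∈-filter⁺ (T? ∘ adj G v) (∈-allFin u) (xs⊆nbrs u∈xs)))
            (≤-reflexive (≡.sym (deg≡length-neighbours v)))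

  deg≤2 : ∀ {v a b} → (∀ {z} → Adj G v z → z ≡ a ⊎ z ≡ b) → deg G v ≤ 2
  deg≤2 {a = a} {b} within = deg≤length {xs = a ∷ b ∷ []} ([ here , there ∘ here ]′ ∘ within)

  3≤deg : ∀ {v a b c} → a ≢ b → a ≢ c → b ≢ c → Adj G v a → Adj G v b → Adj G v c → 3 ≤ deg G v
  3≤deg {a = a} {b} {c} a≢b a≢c b≢c v~a v~b v~c =
    length≤deg {xs = a ∷ b ∷ c ∷ []} ((a≢b ∷ a≢c ∷ []) ∷ (b≢c ∷ []) ∷ [] ∷ [])
      λ { (here refl) → v~a ; (there (here refl)) → v~b ; (there (there (here refl))) → v~c }

  third-neighbour-or-within : ∀ v a b →
    (∃ λ z → Adj G v z × z ≢ a × z ≢ b) ⊎ (∀ {z} → Adj G v z → z ≡ a ⊎ z ≡ b)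
  third-neighbour-or-within v a b
    with any? (λ z → T? (adj G v z) ×-dec ¬? (z ≟ a) ×-dec ¬? (z ≟ b))
  ... | yes third = inj₁ third
  ... | no none   = inj₂ within
    where
    within : ∀ {z} → Adj G v z → z ≡ a ⊎ z ≡ b
    within {z} v~z with z ≟ a | z ≟ b
    ... | yes z≡a | _       = inj₁ z≡a
    ... | no _    | yes z≡b = inj₂ z≡b
    ... | no z≢a  | no z≢b  = ⊥-elim (none (z , v~z , z≢a , z≢b))

  third-neighbour : ∀ {v} → 3 ≤ deg G v → ∀ a b → ∃ λ z → Adj G v z × z ≢ a × z ≢ b
  third-neighbour 3≤d a b with third-neighbour-or-within _ a b
  ... | inj₁ third  = third
  ... | inj₂ within = ⊥-elim (<⇒≱ (s<s (s<s z<s)) (≤-trans 3≤d (deg≤2 within)))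

  -- Walks and paths in acyclic graphs

  visited : ∀ {s t k} → Walk G s t k → List (Fin n)
  visited here                  = []
  visited (step {w = w} _ W) = w ∷ visited W

  IsPath : ∀ {s t k} → Walk G s t k → Set
  IsPath {s} W = Unique (s ∷ visited W)

  length-visited : ∀ {s t k} (W : Walk G s t k) → length (visited W) ≡ k
  length-visited here       = refl
  length-visited (step _ W) = ≡.cong suc (length-visited W)

  end∈visited : ∀ {s t k} (W : Walk G s t k) → t ∈ s ∷ visited W
  end∈visited here       = here refl
  end∈visited (step _ W) = there (end∈visited W)

  linked-closing : ∀ {s t k x} (W : Walk G s t k) → Adj G t x → Linked (Adj G) (s ∷ visited W ++ [ x ])
  linked-closing here        t~x = t~x ∷ [-]
  linked-closing (step a W) t~x = a ∷ linked-closing W t~x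

  closed-path⇒cycle : ∀ {s t k} (W : Walk G s t (suc (suc k))) → IsPath W → Adj G t s → HasCycle G
  closed-path⇒cycle {s} W isPath t~s =
    s , visited W , subst (2 ≤_) (≡.sym (length-visited W)) (s≤s (s≤s z≤n)) , isPath , linked-closing W t~s

  record Split {s t m} (P : Walk G s t m) (c : Fin n) : Set where
    field
      i j           : ℕ
      prefix        : Walk G s c (suc i)
      suffix        : Walk G c t j
      length-split  : suc i + j ≡ m
      visited-split : visited P ≡ visited prefix ++ visited suffix

  split : ∀ {s t m c} (P : Walk G s t m) → c ∈ visited P → Split P c
  split (step a P) (here refl) = record
    { i = 0 ; j = _ ; prefix = step a here ; suffix = P ; length-split = refl ; visited-split = refl }
  split (step a P) (there c∈P) = record
    { i = suc i ; j = j ; prefix = step a prefix ; suffix = suffix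
    ; length-split = ≡.cong suc length-split ; visited-split = ≡.cong (_ ∷_) visited-split }
    where open Split (split P c∈P)

  -- Follow the walk: a vertex off the path extends the path backwards, and a return to the
  -- path closes a cycle unless it lands on the path's second vertex.
  path-shortest : ∀ {s t m k} → ¬ HasCycle G → (P : Walk G s t m) → IsPath P → Walk G s t k → m ≤ k
  path-shortest _ here       _            here = z≤n
  path-shortest _ (step _ P) (s∉P ∷ _) here = ⊥-elim (Allₚ.All¬⇒¬Any s∉P (end∈visited P))
  path-shortest {s} acyclic P isPath (step {w = c} s~c W) with c ∈? s ∷ visited P
  ... | no c∉P =
    m<n⇒m≤1+n (path-shortest acyclic (step (Adj-sym s~c) P) (Allₚ.¬Any⇒All¬ _ c∉P ∷ isPath) W)
  ... | yes (here refl) = ⊥-elim (Adj-irrefl s~c)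
  ... | yes (there c∈P) with split P c∈P
  ... | record { prefix = step _ here ; suffix = P₂ ; length-split = refl ; visited-split = eq }
    with _ ∷ isPath₂ ← subst (λ vs → Unique (s ∷ vs)) eq isPath =
    s≤s (path-shortest acyclic P₂ isPath₂ W)
  ... | record { prefix = P₁@(step _ (step _ _)) ; visited-split = eq } =
    ⊥-elim (acyclic (closed-path⇒cycle P₁ (unique-++⁻ˡ (s ∷ visited P₁) (subst (λ vs → Unique (s ∷ vs)) eq isPath))
                                       (Adj-sym s~c)))

  -- Trees of diameter 3

  -- If w ≢ u, then w, a, u, v, y is a path of length 4, while y lies within 3 steps of w.
  two-steps-return : ∀ {u v y} → ¬ HasCycle G → (∀ w → ∃ λ k → k ≤ 3 × Walk G w y k) →
    Adj G u v → Adj G v y → u ≢ y → ¬ Adj G y u →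
    ∀ {w a} → Adj G w a → Adj G a u → a ≢ v → w ≡ u
  two-steps-return {u} {v} {y} acyclic reach u~v v~y u≢y y≁u {w} {a} w~a a~u a≢v = returns (w ≟ u) (w ≟ v) (w ≟ y)
    where
    auvy : Walk G a y 3
    auvy = step a~u (step u~v (step v~y here))
    a≢y : a ≢ y
    a≢y refl = y≁u a~u
    auvy-path : IsPath auvy
    auvy-path = (Adj⇒≢ a~u ∷ a≢v ∷ a≢y ∷ []) ∷ (Adj⇒≢ u~v ∷ u≢y ∷ []) ∷ (Adj⇒≢ v~y ∷ []) ∷ []
              ∷ []
    returns : Dec (w ≡ u) → Dec (w ≡ v) → Dec (w ≡ y) → w ≡ u
    returns (yes w≡u) _ _ = w≡u
    returns (no _) (yes w≡v) _ =
      ⊥-elim (<⇒≱ (s<s z<s) (path-shortest acyclic (step v~a (step a~u here)) vau-path (step (Adj-sym u~v) here)))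
      where
      v~a : Adj G v a
      v~a = subst (λ x → Adj G x a) w≡v w~a
      vau-path : IsPath (step v~a (step a~u here))
      vau-path = (Adj⇒≢ v~a ∷ ≢-sym (Adj⇒≢ u~v) ∷ []) ∷ (Adj⇒≢ a~u ∷ []) ∷ [] ∷ []
    returns (no _) (no _) (yes w≡y) =
      ⊥-elim (<⇒≱ (s<s z<s) (path-shortest acyclic auvy auvy-path (step a~y here)))
      where
      a~y : Adj G a y
      a~y = Adj-sym (subst (λ x → Adj G x a) w≡y w~a)
    returns (no w≢u) (no w≢v) (no w≢y) with k , k≤3 , W ← reach w =
      ⊥-elim (<⇒≱ (s≤s k≤3) (path-shortest acyclic (step w~a auvy) (w∉auvy ∷ auvy-path) W))
      where
      w∉auvy : All (w ≢_) (a ∷ u ∷ v ∷ y ∷ [])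
      w∉auvy = Adj⇒≢ w~a ∷ w≢u ∷ w≢v ∷ w≢y ∷ []

  record DoubleStar (p q : Fin n) : Set where
    field
      p~q                 : Adj G p q
      attach              : ∀ {w} → w ≢ p → w ≢ q → Adj G w p ⊎ Adj G w q
      leaf-neighbour      : ∀ {w z} → w ≢ p → w ≢ q → Adj G w z → z ≡ p ⊎ z ≡ q
      no-common-neighbour : ∀ {w} → Adj G w p → Adj G w q → ⊥
      pleaf               : Fin n
      pleaf~p             : Adj G pleaf p
      pleaf≢q             : pleaf ≢ q
      qleaf               : Fin n
      qleaf~q             : Adj G qleaf q
      qleaf≢p             : qleaf ≢ p

  DoubleStar-swap : ∀ {p q} → DoubleStar p q → DoubleStar q p
  DoubleStar-swap ds = record
    { p~q = Adj-sym p~q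
    ; attach = λ w≢q w≢p → Sum.swap (attach w≢p w≢q)
    ; leaf-neighbour = λ w≢q w≢p w~z → Sum.swap (leaf-neighbour w≢p w≢q w~z)
    ; no-common-neighbour = λ w~q w~p → no-common-neighbour w~p w~q
    ; pleaf = qleaf ; pleaf~p = qleaf~q ; pleaf≢q = qleaf≢p
    ; qleaf = pleaf ; qleaf~q = pleaf~p ; qleaf≢p = pleaf≢q
    }
    where open DoubleStar ds

  far-apart⇒path-of-length-3 : ∀ {x y k} → (∀ k → Walk G x y k → 3 ≤ k) → k ≤ 3 → Walk G x y k →
    ∃₂ λ u v → Adj G x u × Adj G u v × Adj G v y
  far-apart⇒path-of-length-3 _ _ (step x~u (step u~v (step v~y here))) = _ , _ , x~u , u~v , v~y
  far-apart⇒path-of-length-3 far _ W@here                   = ⊥-elim (<⇒≱ z<s (far _ W))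
  far-apart⇒path-of-length-3 far _ W@(step _ here)          = ⊥-elim (<⇒≱ (s<s z<s) (far _ W))
  far-apart⇒path-of-length-3 far _ W@(step _ (step _ here)) = ⊥-elim (<⇒≱ (s<s (s<s z<s)) (far _ W))
  far-apart⇒path-of-length-3 far (s≤s (s≤s (s≤s ()))) (step _ (step _ (step _ (step _ _))))

  diametral-path⇒DoubleStar : ¬ HasCycle G → Connected G → ∀ {x u v y} →
    (∀ a b → ∃ λ k → k ≤ 3 × Walk G a b k) → (∀ k → Walk G x y k → 3 ≤ k) →
    Adj G x u → Adj G u v → Adj G v y → DoubleStar u v
  diametral-path⇒DoubleStar acyclic connected {x} {u} {v} {y} reach far x~u u~v v~y = record
    { p~q = u~v
    ; attach = attach
    ; leaf-neighbour = leaf-neighbour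
    ; no-common-neighbour = λ w~u w~v → Adj⇒≢ u~v (≡.sym (returns-u (Adj-sym w~v) w~u (Adj⇒≢ w~v)))
    ; pleaf = x ; pleaf~p = x~u ; pleaf≢q = ≢-sym v≢x
    ; qleaf = y ; qleaf~q = Adj-sym v~y ; qleaf≢p = ≢-sym u≢y
    }
    where
    too-short : ∀ {k} → k < 3 → Walk G x y k → ⊥
    too-short k<3 W = <⇒≱ k<3 (far _ W)

    u≢y : u ≢ y
    u≢y u≡y = too-short (s<s z<s) (step (subst (Adj G x) u≡y x~u) here)
    y≁u : ¬ Adj G y u
    y≁u y~u = too-short (s<s (s<s z<s)) (step x~u (step (Adj-sym y~u) here))
    v≢x : v ≢ x
    v≢x v≡x = too-short (s<s z<s) (step (subst (λ z → Adj G z y) v≡x v~y) here)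
    x≁v : ¬ Adj G x v
    x≁v x~v = too-short (s<s (s<s z<s)) (step x~v (step v~y here))

    returns-u : ∀ {w a} → Adj G w a → Adj G a u → a ≢ v → w ≡ u
    returns-u = two-steps-return acyclic (λ w → reach w y) u~v v~y u≢y y≁u
    returns-v : ∀ {w a} → Adj G w a → Adj G a v → a ≢ u → w ≡ v
    returns-v = two-steps-return acyclic (λ w → reach w x) (Adj-sym u~v) (Adj-sym x~u) v≢x x≁v

    Near : Fin n → Set
    Near w = w ≡ u ⊎ w ≡ v ⊎ Adj G w u ⊎ Adj G w v

    near-step : ∀ {w a} → Adj G w a → Near a → Near w
    near-step w~a (inj₁ refl)        = inj₂ (inj₂ (inj₁ w~a))
    near-step w~a (inj₂ (inj₁ refl)) = inj₂ (inj₂ (inj₂ w~a))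
    near-step {a = a} w~a (inj₂ (inj₂ (inj₁ a~u))) with a ≟ v
    ... | yes refl = inj₂ (inj₂ (inj₂ w~a))
    ... | no a≢v   = inj₁ (returns-u w~a a~u a≢v)
    near-step {a = a} w~a (inj₂ (inj₂ (inj₂ a~v))) with a ≟ u
    ... | yes refl = inj₂ (inj₂ (inj₁ w~a))
    ... | no a≢u   = inj₂ (inj₁ (returns-v w~a a~v a≢u))

    near-along : ∀ {w t k} → Walk G w t k → Near t → Near w
    near-along here       near-t = near-t
    near-along (step w~a W) near-t = near-step w~a (near-along W near-t)

    near : ∀ w → Near w
    near w = near-along (proj₂ (connected w u)) (inj₁ refl)

    attach : ∀ {w} → w ≢ u → w ≢ v → Adj G w u ⊎ Adj G w v
    attach {w} w≢u w≢v with near w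
    ... | inj₁ w≡u        = ⊥-elim (w≢u w≡u)
    ... | inj₂ (inj₁ w≡v) = ⊥-elim (w≢v w≡v)
    ... | inj₂ (inj₂ w~c) = w~c

    leaf-neighbour : ∀ {w z} → w ≢ u → w ≢ v → Adj G w z → z ≡ u ⊎ z ≡ v
    leaf-neighbour {z = z} w≢u w≢v w~z with near z | z ≟ u | z ≟ v
    ... | _ | yes z≡u | _ = inj₁ z≡u
    ... | _ | no _ | yes z≡v = inj₂ z≡v
    ... | inj₁ z≡u                | no z≢u | no _   = ⊥-elim (z≢u z≡u)
    ... | inj₂ (inj₁ z≡v)         | no _   | no z≢v = ⊥-elim (z≢v z≡v)
    ... | inj₂ (inj₂ (inj₁ z~u)) | no _   | no z≢v = ⊥-elim (w≢u (returns-u w~z z~u z≢v))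
    ... | inj₂ (inj₂ (inj₂ z~v)) | no z≢u | no _   = ⊥-elim (w≢v (returns-v w~z z~v z≢u))

  diameter-3-tree⇒DoubleStar : IsTree G → HasDiameter G 3 → ∃₂ λ p q → DoubleStar p q
  diameter-3-tree⇒DoubleStar (connected , acyclic) (reach , x , y , far)
    with _ , k≤3 , W ← reach x y
    with u , v , x~u , u~v , v~y ← far-apart⇒path-of-length-3 far k≤3 W
    = u , v , diametral-path⇒DoubleStar acyclic connected reach far x~u u~v v~y

  -- Edges and the middle graph

  infix 4 _∈ₑ_
  _∈ₑ_ : Fin n → Edge G → Set
  z ∈ₑ ((i , j) , _) = z ≡ i ⊎ z ≡ j

  joinEdge : ∀ {a b} → Adj G a b → Edge G
  joinEdge {a} {b} a~b with <-cmp a b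
  ... | tri< a<b _ _ = (a , b) , a<b , a~b
  ... | tri≈ _ a≡b _ = ⊥-elim (Adj⇒≢ a~b a≡b)
  ... | tri> _ _ b<a = (b , a) , b<a , Adj-sym a~b

  ∈ₑ-joinEdge : ∀ {a b z} (a~b : Adj G a b) → z ∈ₑ joinEdge a~b ⇔ (z ≡ a ⊎ z ≡ b)
  ∈ₑ-joinEdge {a} {b} a~b with <-cmp a b
  ... | tri< _ _ _   = mk⇔ id id
  ... | tri≈ _ a≡b _ = ⊥-elim (Adj⇒≢ a~b a≡b)
  ... | tri> _ _ _   = mk⇔ Sum.swap Sum.swap

  ∈ₑ-adjacent : ∀ {a b} (e : Edge G) → a ∈ₑ e → b ∈ₑ e → a ≡ b ⊎ Adj G a b
  ∈ₑ-adjacent _             (inj₁ refl) (inj₁ refl) = inj₁ refl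
  ∈ₑ-adjacent (_ , _ , i~j) (inj₁ refl) (inj₂ refl) = inj₂ i~j
  ∈ₑ-adjacent (_ , _ , i~j) (inj₂ refl) (inj₁ refl) = inj₂ (Adj-sym i~j)
  ∈ₑ-adjacent _             (inj₂ refl) (inj₂ refl) = inj₁ refl

  other-endpoint : ∀ {w} (e : Edge G) → w ∈ₑ e → ∃ λ o → o ∈ₑ e × Adj G w o
  other-endpoint (_ , _ , i~j) (inj₁ refl) = _ , inj₂ refl , i~j
  other-endpoint (_ , _ , i~j) (inj₂ refl) = _ , inj₁ refl , Adj-sym i~j

  endpoints-determine-edge : ∀ {a b} (e e′ : Edge G) → a ≢ b →
    a ∈ₑ e → b ∈ₑ e → a ∈ₑ e′ → b ∈ₑ e′ → proj₁ e ≡ proj₁ e′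
  endpoints-determine-edge _ _ a≢b (inj₁ refl) (inj₁ refl) _ _ = ⊥-elim (a≢b refl)
  endpoints-determine-edge _ _ a≢b (inj₂ refl) (inj₂ refl) _ _ = ⊥-elim (a≢b refl)
  endpoints-determine-edge _ _ a≢b _ _ (inj₁ refl) (inj₁ refl) = ⊥-elim (a≢b refl)
  endpoints-determine-edge _ _ a≢b _ _ (inj₂ refl) (inj₂ refl) = ⊥-elim (a≢b refl)
  endpoints-determine-edge _ _ _ (inj₁ refl) (inj₂ refl) (inj₁ refl) (inj₂ refl) = refl
  endpoints-determine-edge _ _ _ (inj₂ refl) (inj₁ refl) (inj₂ refl) (inj₁ refl) = refl
  endpoints-determine-edge (_ , i<j , _) (_ , k<l , _) _ (inj₁ refl) (inj₂ refl) (inj₂ refl) (inj₁ refl) =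
    ⊥-elim (<-asym i<j k<l)
  endpoints-determine-edge (_ , i<j , _) (_ , k<l , _) _ (inj₂ refl) (inj₁ refl) (inj₁ refl) (inj₂ refl) =
    ⊥-elim (<-asym i<j k<l)

  ∈ₑ-resp : ∀ {z} (e e′ : Edge G) → proj₁ e ≡ proj₁ e′ → z ∈ₑ e → z ∈ₑ e′
  ∈ₑ-resp _ _ refl z∈e = z∈e

  distinct-edges : ∀ {x} (e e′ : Edge G) → x ∈ₑ e → ¬ x ∈ₑ e′ → proj₁ e ≢ proj₁ e′
  distinct-edges e e′ x∈e x∉e′ same = x∉e′ (∈ₑ-resp e e′ same x∈e)

  shared-endpoint⇒MAdj : ∀ {z x} (e e′ : Edge G) → z ∈ₑ e → z ∈ₑ e′ → x ∈ₑ e → ¬ x ∈ₑ e′ →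
    MAdj G (inj₂ e) (inj₂ e′)
  shared-endpoint⇒MAdj e e′ (inj₁ refl) (inj₁ refl) x∈e x∉e′ = distinct-edges e e′ x∈e x∉e′ , inj₁ refl
  shared-endpoint⇒MAdj e e′ (inj₁ refl) (inj₂ refl) x∈e x∉e′ = distinct-edges e e′ x∈e x∉e′ , inj₂ (inj₁ refl)
  shared-endpoint⇒MAdj e e′ (inj₂ refl) (inj₁ refl) x∈e x∉e′ = distinct-edges e e′ x∈e x∉e′ , inj₂ (inj₂ (inj₁ refl))
  shared-endpoint⇒MAdj e e′ (inj₂ refl) (inj₂ refl) x∈e x∉e′ = distinct-edges e e′ x∈e x∉e′ , inj₂ (inj₂ (inj₂ refl))

  MAdj⇒shared-endpoint : ∀ (e e′ : Edge G) → MAdj G (inj₂ e) (inj₂ e′) → ∃ λ z → z ∈ₑ e × z ∈ₑ e′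
  MAdj⇒shared-endpoint _ _ (_ , inj₁ i≡k)               = _ , inj₁ refl , inj₁ i≡k
  MAdj⇒shared-endpoint _ _ (_ , inj₂ (inj₁ i≡l))        = _ , inj₁ refl , inj₂ i≡l
  MAdj⇒shared-endpoint _ _ (_ , inj₂ (inj₂ (inj₁ j≡k))) = _ , inj₂ refl , inj₁ j≡k
  MAdj⇒shared-endpoint _ _ (_ , inj₂ (inj₂ (inj₂ j≡l))) = _ , inj₂ refl , inj₂ j≡l

  -- Total domination in the middle graph of a double star

  DominatedBy : List (MVertex G) → MVertex G → Set
  DominatedBy S v = ∃ λ u → u ∈ S × MAdj G v u

  dominated-vertex⇒incident-edge : ∀ {S w} → DominatedBy S (inj₁ w) → ∃ λ e → inj₂ e ∈ S × w ∈ₑ e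
  dominated-vertex⇒incident-edge (inj₂ e , e∈S , w∈e) = e , e∈S , w∈e

  module DoubleStarProperties {p q : Fin n} (ds : DoubleStar p q) where

    open DoubleStar ds

    Leaf : Fin n → Set
    Leaf w = w ≢ p × w ≢ q

    position : ∀ w → w ≡ p ⊎ w ≡ q ⊎ Leaf w
    position w with w ≟ p | w ≟ q
    ... | yes w≡p | _       = inj₁ w≡p
    ... | no _    | yes w≡q = inj₂ (inj₁ w≡q)
    ... | no w≢p  | no w≢q  = inj₂ (inj₂ (w≢p , w≢q))

    pleaf-leaf : Leaf pleaf
    pleaf-leaf = Adj⇒≢ pleaf~p , pleaf≢q

    qleaf-leaf : Leaf qleaf
    qleaf-leaf = qleaf≢p , Adj⇒≢ qleaf~q

    leaf-neighbours-equal : ∀ {w c c′} → Leaf w → Adj G w c → Adj G w c′ → c ≡ c′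
    leaf-neighbours-equal (w≢p , w≢q) w~c w~c′
      with leaf-neighbour w≢p w≢q w~c | leaf-neighbour w≢p w≢q w~c′
    ... | inj₁ refl | inj₁ refl = refl
    ... | inj₂ refl | inj₂ refl = refl
    ... | inj₁ refl | inj₂ refl = ⊥-elim (no-common-neighbour w~c w~c′)
    ... | inj₂ refl | inj₁ refl = ⊥-elim (no-common-neighbour w~c′ w~c)

    leaves-nonadjacent : ∀ {w w′} → Leaf w → Leaf w′ → ¬ Adj G w w′
    leaves-nonadjacent (w≢p , w≢q) (w′≢p , w′≢q) w~w′ =
      [ w′≢p , w′≢q ]′ (leaf-neighbour w≢p w≢q w~w′)

    leaf-unique-in-edge : ∀ {w w′} (e : Edge G) → Leaf w → Leaf w′ → w ∈ₑ e → w′ ∈ₑ e → w ≡ w′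
    leaf-unique-in-edge e l l′ w∈e w′∈e =
      [ id , ⊥-elim ∘ leaves-nonadjacent l l′ ]′ (∈ₑ-adjacent e w∈e w′∈e)

    leaf-edges-coincide : ∀ {w} (e e′ : Edge G) → Leaf w → w ∈ₑ e → w ∈ₑ e′ → proj₁ e ≡ proj₁ e′
    leaf-edges-coincide e e′ l w∈e w∈e′
      with o , o∈e , w~o ← other-endpoint e w∈e | o′ , o′∈e′ , w~o′ ← other-endpoint e′ w∈e′ =
      endpoints-determine-edge e e′ (Adj⇒≢ w~o) w∈e o∈e w∈e′
        (subst (_∈ₑ e′) (≡.sym (leaf-neighbours-equal l w~o w~o′)) o′∈e′)

    -- Parents in the tree rooted at q, so that the edges {w, parent w} with w ≢ q are the
    -- edges of T; the value parent q = p is junk.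
    parent : Fin n → Fin n
    parent w with position w
    ... | inj₁ _                  = q
    ... | inj₂ (inj₁ _)           = p
    ... | inj₂ (inj₂ (w≢p , w≢q)) = [ const p , const q ]′ (attach w≢p w≢q)

    parent-adj : ∀ w → Adj G w (parent w)
    parent-adj w with position w
    ... | inj₁ refl               = p~q
    ... | inj₂ (inj₁ refl)        = Adj-sym p~q
    ... | inj₂ (inj₂ (w≢p , w≢q)) with attach w≢p w≢q
    ...   | inj₁ w~p = w~p
    ...   | inj₂ w~q = w~q

    parent-central : ∀ w → parent w ≡ p ⊎ parent w ≡ q
    parent-central w with position w
    ... | inj₁ _                  = inj₂ refl
    ... | inj₂ (inj₁ _)           = inj₁ refl
    ... | inj₂ (inj₂ (w≢p , w≢q)) with attach w≢p w≢q
    ...   | inj₁ _ = inj₁ refl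
    ...   | inj₂ _ = inj₂ refl

    parent-p : parent p ≡ q
    parent-p with position p
    ... | inj₁ _                 = refl
    ... | inj₂ (inj₁ p≡q)        = ⊥-elim (Adj⇒≢ p~q p≡q)
    ... | inj₂ (inj₂ (p≢p , _)) = ⊥-elim (p≢p refl)

    edgeOf : Fin n → Edge G
    edgeOf w = joinEdge (parent-adj w)

    ∈ₑ-edgeOf : ∀ {z} w → z ∈ₑ edgeOf w ⇔ (z ≡ w ⊎ z ≡ parent w)
    ∈ₑ-edgeOf w = ∈ₑ-joinEdge (parent-adj w)

    ∈ₑ-edgeOf-p : ∀ {z} → z ∈ₑ edgeOf p ⇔ (z ≡ p ⊎ z ≡ q)
    ∈ₑ-edgeOf-p {z} = subst (λ r → z ∈ₑ edgeOf p ⇔ (z ≡ p ⊎ z ≡ r)) parent-p (∈ₑ-edgeOf p)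

    ∈ₑ-edgeOf-self : ∀ w → w ∈ₑ edgeOf w
    ∈ₑ-edgeOf-self w = Equivalence.from (∈ₑ-edgeOf w) (inj₁ refl)

    neighbour-∈ₑ-edgeOf-leaf : ∀ {w c} → Leaf w → Adj G w c → c ∈ₑ edgeOf w
    neighbour-∈ₑ-edgeOf-leaf {w} l w~c =
      Equivalence.from (∈ₑ-edgeOf w) (inj₂ (leaf-neighbours-equal l w~c (parent-adj w)))

    ∈ₑ-edgeOf-leaf⁻ : ∀ {w z} → Leaf w → z ∈ₑ edgeOf w → z ≡ w ⊎ Adj G w z
    ∈ₑ-edgeOf-leaf⁻ {w} l z∈e =
      Sum.map₂ (λ z≡parent → subst (Adj G w) (≡.sym z≡parent) (parent-adj w)) (Equivalence.to (∈ₑ-edgeOf w) z∈e)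

    edgeOf-injective : ∀ {w w′} → w ≢ q → w′ ≢ q → edgeOf w ≡ edgeOf w′ → w ≡ w′
    edgeOf-injective {w} {w′} w≢q w′≢q same
      with Equivalence.to (∈ₑ-edgeOf w′) (subst (w ∈ₑ_) same (∈ₑ-edgeOf-self w))
         | Equivalence.to (∈ₑ-edgeOf w) (subst (w′ ∈ₑ_) (≡.sym same) (∈ₑ-edgeOf-self w′))
    ... | inj₁ w≡w′ | _ = w≡w′
    ... | inj₂ _ | inj₁ w′≡w = ≡.sym w′≡w
    ... | inj₂ w≡parent | inj₂ w′≡parent with parent-central w′
    ...   | inj₂ parent≡q = ⊥-elim (w≢q (≡.trans w≡parent parent≡q))
    ...   | inj₁ parent≡p = ⊥-elim (w′≢q (begin
      w′       ≡⟨ w′≡parent ⟩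
      parent w ≡⟨ ≡.cong parent (≡.trans w≡parent parent≡p) ⟩
      parent p ≡⟨ parent-p ⟩
      q        ∎))
      where open ≡.≡-Reasoning

    nonRoot : List (Fin n)
    nonRoot = filter (λ w → ¬? (w ≟ q)) (allFin n)

    leaves : List (Fin n)
    leaves = filter (λ w → ¬? (w ≟ p)) nonRoot

    treeEdges : List (MVertex G)
    treeEdges = map (inj₂ ∘ edgeOf) nonRoot

    pendantEdges : List (MVertex G)
    pendantEdges = map (inj₂ ∘ edgeOf) leaves

    ∈-nonRoot : ∀ {w} → w ≢ q → w ∈ nonRoot
    ∈-nonRoot {w} w≢q = ∈-filter⁺ (λ w → ¬? (w ≟ q)) (∈-allFin w) w≢q

    ∈-leaves : ∀ {w} → Leaf w → w ∈ leaves
    ∈-leaves (w≢p , w≢q) = ∈-filter⁺ (λ w → ¬? (w ≟ p)) (∈-nonRoot w≢q) w≢p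

    length-nonRoot : suc (length nonRoot) ≤ n
    length-nonRoot = ≤-trans (filter-notAll (λ w → ¬? (w ≟ q)) (allFin n) q∉)
                             (≤-reflexive (length-tabulate id))
      where
      q∉ : Any (λ w → ¬ w ≢ q) (allFin n)
      q∉ = Any.map (λ q≡w w≢q → w≢q (≡.sym q≡w)) (∈-allFin q)

    length-leaves : suc (length leaves) ≤ length nonRoot
    length-leaves = filter-notAll (λ w → ¬? (w ≟ p)) nonRoot
                      (Any.map (λ p≡w w≢p → w≢p (≡.sym p≡w)) (∈-nonRoot (Adj⇒≢ p~q)))

    all-nonRoot : All (_≢ q) nonRoot
    all-nonRoot = Allₚ.all-filter (λ w → ¬? (w ≟ q)) (allFin n)

    nonRoot-unique : Unique nonRoot
    nonRoot-unique = Unique.filter⁺ (λ w → ¬? (w ≟ q)) (Unique.allFin⁺ n)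

    edgeOf-unique : ∀ {ws} → All (_≢ q) ws → Unique ws → Unique (map (inj₂ ∘ edgeOf) ws)
    edgeOf-unique = map⁺-injectiveOn (λ w≢q w′≢q → edgeOf-injective w≢q w′≢q ∘ inj₂-injective {A = Fin n})

    treeEdges-unique : Unique treeEdges
    treeEdges-unique = edgeOf-unique all-nonRoot nonRoot-unique

    pendantEdges-unique : Unique pendantEdges
    pendantEdges-unique = edgeOf-unique (Allₚ.filter⁺ (λ w → ¬? (w ≟ p)) all-nonRoot)
                                        (Unique.filter⁺ (λ w → ¬? (w ≟ p)) nonRoot-unique)

    length-treeEdges : length treeEdges ≤ n ∸ 1
    length-treeEdges = ≤-trans (≤-reflexive (length-map _ nonRoot)) (∸-monoˡ-≤ 1 length-nonRoot)

    length-pendantEdges : length pendantEdges ≤ n ∸ 2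
    length-pendantEdges =
      ≤-trans (≤-reflexive (length-map _ leaves)) (∸-monoˡ-≤ 2 (≤-trans (s≤s length-leaves) length-nonRoot))

    edge-kind : ∀ e → (p ∈ₑ e × q ∈ₑ e) ⊎ (∃₂ λ w c → Leaf w × Adj G w c × w ∈ₑ e × c ∈ₑ e)
    edge-kind ((i , j) , _ , i~j) with position i | position j
    ... | inj₂ (inj₂ lᵢ) | _              = inj₂ (i , j , lᵢ , i~j , inj₁ refl , inj₂ refl)
    ... | _              | inj₂ (inj₂ lⱼ) = inj₂ (j , i , lⱼ , Adj-sym i~j , inj₂ refl , inj₁ refl)
    ... | inj₁ refl        | inj₂ (inj₁ refl) = inj₁ (inj₁ refl , inj₂ refl)
    ... | inj₂ (inj₁ refl) | inj₁ refl        = inj₁ (inj₂ refl , inj₁ refl)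
    ... | inj₁ refl        | inj₁ refl        = ⊥-elim (Adj-irrefl i~j)
    ... | inj₂ (inj₁ refl) | inj₂ (inj₁ refl) = ⊥-elim (Adj-irrefl i~j)

    dominating : ∀ {S} → (∀ {w} → Leaf w → inj₂ (edgeOf w) ∈ S) →
      (∀ {w c} e → Leaf w → Adj G w c → w ∈ₑ e → c ∈ₑ e → DominatedBy S (inj₂ e)) →
      IsTotalDominating (MAdj G) S
    dominating pendant∈S leaf-edge-dominated (inj₁ w) with position w
    ... | inj₁ refl        = _ , pendant∈S pleaf-leaf , neighbour-∈ₑ-edgeOf-leaf pleaf-leaf pleaf~p
    ... | inj₂ (inj₁ refl) = _ , pendant∈S qleaf-leaf , neighbour-∈ₑ-edgeOf-leaf qleaf-leaf qleaf~q
    ... | inj₂ (inj₂ l)    = _ , pendant∈S l , ∈ₑ-edgeOf-self w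
    dominating pendant∈S leaf-edge-dominated (inj₂ e) with edge-kind e
    ... | inj₂ (_ , _ , l , w~c , w∈e , c∈e) = leaf-edge-dominated e l w~c w∈e c∈e
    ... | inj₁ (p∈e , q∈e) =
      _ , pendant∈S pleaf-leaf ,
      shared-endpoint⇒MAdj e (edgeOf pleaf) p∈e (neighbour-∈ₑ-edgeOf-leaf pleaf-leaf pleaf~p) q∈e q∉
      where
      q∉ : ¬ q ∈ₑ edgeOf pleaf
      q∉ q∈ = [ pleaf≢q ∘ ≡.sym , no-common-neighbour pleaf~p ]′ (∈ₑ-edgeOf-leaf⁻ pleaf-leaf q∈)

    treeEdges-dominating : IsTotalDominating (MAdj G) treeEdges
    treeEdges-dominating = dominating (∈-map⁺ _ ∘ ∈-nonRoot ∘ proj₂) centre-edge-dominates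
      where
      centre-edge-dominates : ∀ {w c} e → Leaf w → Adj G w c → w ∈ₑ e → c ∈ₑ e →
        DominatedBy treeEdges (inj₂ e)
      centre-edge-dominates e l@(w≢p , w≢q) w~c w∈e c∈e =
        _ , ∈-map⁺ _ (∈-nonRoot (Adj⇒≢ p~q)) ,
        shared-endpoint⇒MAdj e (edgeOf p) c∈e (Equivalence.from ∈ₑ-edgeOf-p (leaf-neighbour w≢p w≢q w~c)) w∈e
          ([ w≢p , w≢q ]′ ∘ Equivalence.to ∈ₑ-edgeOf-p)

    another-leaf : 3 ≤ deg G p → 3 ≤ deg G q → ∀ {c} → c ≡ p ⊎ c ≡ q → ∀ w →
      ∃ λ w′ → Leaf w′ × Adj G w′ c × w′ ≢ w
    another-leaf 3≤deg-p _ (inj₁ refl) w with z , p~z , z≢q , z≢w ← third-neighbour 3≤deg-p q w =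
      z , (≢-sym (Adj⇒≢ p~z) , z≢q) , Adj-sym p~z , z≢w
    another-leaf _ 3≤deg-q (inj₂ refl) w with z , q~z , z≢p , z≢w ← third-neighbour 3≤deg-q p w =
      z , (z≢p , ≢-sym (Adj⇒≢ q~z)) , Adj-sym q~z , z≢w

    pendantEdges-dominating : 3 ≤ deg G p → 3 ≤ deg G q → IsTotalDominating (MAdj G) pendantEdges
    pendantEdges-dominating 3≤deg-p 3≤deg-q = dominating (∈-map⁺ _ ∘ ∈-leaves) sibling-edge-dominates
      where
      sibling-edge-dominates : ∀ {w c} e → Leaf w → Adj G w c → w ∈ₑ e → c ∈ₑ e →
        DominatedBy pendantEdges (inj₂ e)
      sibling-edge-dominates {w} e l@(w≢p , w≢q) w~c w∈e c∈e
        with w′ , l′ , w′~c , w′≢w ← another-leaf 3≤deg-p 3≤deg-q (leaf-neighbour w≢p w≢q w~c) w =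
        _ , ∈-map⁺ _ (∈-leaves l′) ,
        shared-endpoint⇒MAdj e (edgeOf w′) c∈e (neighbour-∈ₑ-edgeOf-leaf l′ w′~c) w∈e
          ([ w′≢w ∘ ≡.sym , leaves-nonadjacent l′ l ]′ ∘ ∈ₑ-edgeOf-leaf⁻ l′)

    pendant-neighbour-avoids-leaves : (∀ {z} → Adj G p z → z ≡ q ⊎ z ≡ pleaf) →
      ∀ e → MAdj G (inj₂ (edgeOf pleaf)) (inj₂ e) → ∀ {w} → Leaf w → ¬ w ∈ₑ e
    pendant-neighbour-avoids-leaves p-only e adj (w≢p , w≢q) w∈e
      with z , z∈e₀ , z∈e ← MAdj⇒shared-endpoint (edgeOf pleaf) e adj
      with ∈ₑ-edgeOf-leaf⁻ pleaf-leaf z∈e₀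
    ... | inj₁ refl     = not-e₀ z∈e
      where
      not-e₀ : ¬ pleaf ∈ₑ e
      not-e₀ = proj₁ adj ∘ leaf-edges-coincide (edgeOf pleaf) e pleaf-leaf (∈ₑ-edgeOf-self pleaf)
    ... | inj₂ pleaf~z
      with refl ← leaf-neighbours-equal pleaf-leaf pleaf~z pleaf~p
      with ∈ₑ-adjacent e z∈e w∈e
    ...   | inj₁ p≡w = w≢p (≡.sym p≡w)
    ...   | inj₂ p~w with p-only p~w
    ...     | inj₁ w≡q = w≢q w≡q
    ...     | inj₂ refl = proj₁ adj (leaf-edges-coincide (edgeOf pleaf) e pleaf-leaf (∈ₑ-edgeOf-self pleaf) w∈e)

    module _ {S : List (MVertex G)} (dom : IsTotalDominating (MAdj G) S) where

      incident-edge : ∀ w → ∃ λ e → inj₂ e ∈ S × w ∈ₑ e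
      incident-edge w = dominated-vertex⇒incident-edge (dom (inj₁ w))

      slot : Fin n → Fin (length S)
      slot w = index (proj₁ (proj₂ (incident-edge w)))

      same-slot⇒same-edge : ∀ {x w} (x∈S : x ∈ S) → index x∈S ≡ slot w → x ≡ inj₂ (proj₁ (incident-edge w))
      same-slot⇒same-edge x∈S = index-injective (≡.setoid (MVertex G)) x∈S _

      slot-injective-on-leaves : ∀ {w w′} → Leaf w → Leaf w′ → slot w ≡ slot w′ → w ≡ w′
      slot-injective-on-leaves {w} {w′} l l′ eq =
        leaf-unique-in-edge e′ l l′ (subst (w ∈ₑ_) (inj₂-injective (same-slot⇒same-edge e∈S eq)) w∈e) w′∈e′
        where
        e′ : Edge G
        e′ = proj₁ (incident-edge w′)
        e∈S : inj₂ (proj₁ (incident-edge w)) ∈ S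
        e∈S = proj₁ (proj₂ (incident-edge w))
        w∈e : w ∈ₑ proj₁ (incident-edge w)
        w∈e = proj₂ (proj₂ (incident-edge w))
        w′∈e′ : w′ ∈ₑ e′
        w′∈e′ = proj₂ (proj₂ (incident-edge w′))

      lower-bound-n∸2 : n ∸ 2 ≤ length S
      lower-bound-n∸2 = m≤n+o⇒m∸n≤o n 2 (injective-off-point⇒≤ q f f-injective)
        where
        f : ∀ w → w ≢ q → Fin (suc (length S))
        f w _ with w ≟ p
        ... | yes _ = zero
        ... | no _  = suc (slot w)
        f-injective : ∀ {w w′} (h : w ≢ q) (h′ : w′ ≢ q) → f w h ≡ f w′ h′ → w ≡ w′
        f-injective {w} {w′} _ _ _ with w ≟ p | w′ ≟ p
        f-injective _ _ _ | yes refl | yes refl = refl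
        f-injective _ _ () | yes _ | no _
        f-injective _ _ () | no _ | yes _
        f-injective w≢q w′≢q eq | no w≢p | no w′≢p =
          slot-injective-on-leaves (w≢p , w≢q) (w′≢p , w′≢q) (suc-injective eq)

      lower-bound-n∸1 : (∀ {z} → Adj G p z → z ≡ q ⊎ z ≡ pleaf) → n ∸ 1 ≤ length S
      lower-bound-n∸1 p-only with s₀ , s₀∈S , e₀~s₀ ← dom (inj₂ (edgeOf pleaf)) =
        m≤n+o⇒m∸n≤o n 1 (injective-off-point⇒≤ q f f-injective)
        where
        s₀-slot-free : ∀ {w} → Leaf w → index s₀∈S ≢ slot w
        s₀-slot-free {w} l eq =
          pendant-neighbour-avoids-leaves p-only (proj₁ (incident-edge w))
            (subst (MAdj G (inj₂ (edgeOf pleaf))) (same-slot⇒same-edge s₀∈S eq) e₀~s₀) l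
            (proj₂ (proj₂ (incident-edge w)))
        f : ∀ w → w ≢ q → Fin (length S)
        f w _ with w ≟ p
        ... | yes _ = index s₀∈S
        ... | no _  = slot w
        f-injective : ∀ {w w′} (h : w ≢ q) (h′ : w′ ≢ q) → f w h ≡ f w′ h′ → w ≡ w′
        f-injective {w} {w′} _ _ _ with w ≟ p | w′ ≟ p
        f-injective _ _ _ | yes refl | yes refl = refl
        f-injective _ w′≢q eq | yes _ | no w′≢p = ⊥-elim (s₀-slot-free (w′≢p , w′≢q) eq)
        f-injective w≢q _ eq | no w≢p | yes _ = ⊥-elim (s₀-slot-free (w≢p , w≢q) (≡.sym eq))
        f-injective w≢q w′≢q eq | no w≢p | no w′≢p = slot-injective-on-leaves (w≢p , w≢q) (w′≢p , w′≢q) eq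

    γₜ≡n∸2 : 3 ≤ deg G p → 3 ≤ deg G q → TotalDominationNumber (MAdj G) (n ∸ 2)
    γₜ≡n∸2 3≤deg-p 3≤deg-q = total-domination-number pendantEdges pendantEdges-unique
      (pendantEdges-dominating 3≤deg-p 3≤deg-q) length-pendantEdges lower-bound-n∸2

    γₜ≡n∸1 : (∀ {z} → Adj G p z → z ≡ q ⊎ z ≡ pleaf) → TotalDominationNumber (MAdj G) (n ∸ 1)
    γₜ≡n∸1 p-only = total-domination-number treeEdges treeEdges-unique treeEdges-dominating length-treeEdges
      (λ dom → lower-bound-n∸1 dom p-only)

    second-leaf⇒3≤deg-p : (∃ λ z → Adj G p z × z ≢ q × z ≢ pleaf) → 3 ≤ deg G p
    second-leaf⇒3≤deg-p (z , p~z , z≢q , z≢pleaf) =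
      3≤deg (≢-sym pleaf≢q) (≢-sym z≢q) (≢-sym z≢pleaf) p~q (Adj-sym pleaf~p) p~z

    large-degree⇒centre : ∀ {v} → 3 ≤ deg G v → v ≡ p ⊎ v ≡ q
    large-degree⇒centre {v} 3≤deg with position v
    ... | inj₁ v≡p            = inj₁ v≡p
    ... | inj₂ (inj₁ v≡q)     = inj₂ v≡q
    ... | inj₂ (inj₂ (v≢p , v≢q)) =
      ⊥-elim (<⇒≱ (s<s (s<s z<s)) (≤-trans 3≤deg (deg≤2 (leaf-neighbour v≢p v≢q))))

theorem3p3 : (n : ℕ) (T : Graph n) → 4 ≤ n → IsTree T → HasDiameter T 3 →
    (TwoVerticesDeg≥3 T → TotalDominationNumber (MAdj T) (n ∸ 2)) ×
    (¬ TwoVerticesDeg≥3 T → TotalDominationNumber (MAdj T) (n ∸ 1))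
theorem3p3 n T _ tree diam
  with p , q , ds ← GraphProperties.diameter-3-tree⇒DoubleStar T tree diam = two-large , one-large
  where
  open GraphProperties T
  open DoubleStar ds
  open DoubleStarProperties ds using (large-degree⇒centre; γₜ≡n∸2; γₜ≡n∸1; second-leaf⇒3≤deg-p)
  open DoubleStarProperties (DoubleStar-swap ds) using ()
    renaming (γₜ≡n∸1 to γₜ≡n∸1-swapped; second-leaf⇒3≤deg-p to second-leaf⇒3≤deg-q)

  two-large : TwoVerticesDeg≥3 T → TotalDominationNumber (MAdj T) (n ∸ 2)
  two-large (a , b , a≢b , 3≤deg-a , 3≤deg-b) with large-degree⇒centre 3≤deg-a | large-degree⇒centre 3≤deg-b
  ... | inj₁ refl | inj₂ refl = γₜ≡n∸2 3≤deg-a 3≤deg-b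
  ... | inj₂ refl | inj₁ refl = γₜ≡n∸2 3≤deg-b 3≤deg-a
  ... | inj₁ refl | inj₁ refl = ⊥-elim (a≢b refl)
  ... | inj₂ refl | inj₂ refl = ⊥-elim (a≢b refl)

  one-large : ¬ TwoVerticesDeg≥3 T → TotalDominationNumber (MAdj T) (n ∸ 1)
  one-large ¬two with third-neighbour-or-within p q pleaf | third-neighbour-or-within q p qleaf
  ... | inj₂ p-only | _           = γₜ≡n∸1 p-only
  ... | inj₁ _      | inj₂ q-only = γₜ≡n∸1-swapped q-only
  ... | inj₁ second-p | inj₁ second-q =
    ⊥-elim (¬two (p , q , Adj⇒≢ p~q , second-leaf⇒3≤deg-p second-p , second-leaf⇒3≤deg-q second-q))
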